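{- Let $g\ge 3$ be an integer. Then the class of line graphs of graphs of girth at least $g$ is not intersectionwise $\chi$-guarding. In particular, the class of line graphs is not intersectionwise $\chi$-guarding.
   Context: All graphs are finite and simple; classes are taken closed under isomorphism and induced subgraphs. The line graph $L(G)$ of $G$ has vertex set $E(G)$, two edges adjacent iff they share an endpoint. The girth of a graph is the length of its shortest cycle (infinite for forests). The graph-intersection of classes $\mathcal{A},\mathcal{B}$ is the class of all graphs $(V(G)\cap V(H),E(G)\cap E(H))$ with $G\in\mathcal{A}$, $H\in\mathcal{B}$. A class is $\chi$-bounded if there is a non-decreasing $f:\mathbb{N}\to\mathbb{N}$ with $\chi(G)\le f(\omega(G))$ for all members. A class $\mathcal{A}$ is intersectionwise $\chi$-guarding if for every $\chi$-bounded class $\mathcal{B}$ the graph-intersection of $\mathcal{A}$ and $\mathcal{B}$ is $\chi$-bounded. -}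

module Defs where

open import Data.Nat using (ℕ; zero; suc; _≤_; _<_)
open import Data.Fin using (Fin; toℕ)
open import Data.Bool using (Bool; true; false; _∧_)
open import Data.Product using (Σ; ∃; ∃-syntax; _×_; _,_; proj₁; proj₂)
open import Data.Sum using (_⊎_)
open import Data.Empty using (⊥)
open import Relation.Binary.PropositionalEquality using (_≡_; _≢_)
open import Relation.Nullary using (¬_)
open import Function.Definitions using (Injective)
open import Function.Bundles using (_⇔_)

record Graph : Set where
  field
    n      : ℕ
    adj    : Fin n → Fin n → Bool
    sym    : ∀ x y → adj x y ≡ adj y x
    irrefl : ∀ x → adj x x ≡ false

open Graph public

V : Graph → Set
V G = Fin (n G)

Edge : (G : Graph) → V G → V G → Set
Edge G x y = adj G x y ≡ true

Class : Set₁
Class = Graph → Set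

InducedSub : Graph → Graph → Set
InducedSub H G =
  Σ (V H → V G) λ f → Injective _≡_ _≡_ f × (∀ x y → adj H x y ≡ adj G (f x) (f y))

Hereditary : Class → Set
Hereditary C = ∀ G H → InducedSub H G → C G → C H

Colorable : Graph → ℕ → Set
Colorable G k = Σ (V G → Fin k) λ c → ∀ x y → Edge G x y → c x ≢ c y

HasClique : Graph → ℕ → Set
HasClique G w =
  Σ (Fin w → V G) λ c → Injective _≡_ _≡_ c × (∀ i j → i ≢ j → Edge G (c i) (c j))

CliqueNumber : Graph → ℕ → Set
CliqueNumber G w = HasClique G w × ¬ HasClique G (suc w)

NonDecreasing : (ℕ → ℕ) → Set
NonDecreasing f = ∀ {a b} → a ≤ b → f a ≤ f b

ChiBounded : Class → Set
ChiBounded C = ∃[ f ] (NonDecreasing f ×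
  (∀ G → C G → ∀ w → CliqueNumber G w → Colorable G (f w)))

-- Graph-intersection of classes: K ∈ A ⊓ B iff there are G ∈ A, H ∈ B
-- such that K = (V(G) ∩ V(H), E(G) ∩ E(H)). Vertex sets being labelled,
-- this means: V(K) embeds injectively into V(G) and into V(H) (the common
-- vertices), and adjacency in K is adjacency in both G and H.
_⊓_ : Class → Class → Class
(A ⊓ B) K = Σ Graph λ G → Σ Graph λ H → A G × B H ×
  Σ (V K → V G) λ f → Σ (V K → V H) λ h →
    Injective _≡_ _≡_ f × Injective _≡_ _≡_ h ×
    (∀ x y → adj K x y ≡ (adj G (f x) (f y) ∧ adj H (h x) (h y)))

IntersectionwiseChiGuarding : Class → Set₁
IntersectionwiseChiGuarding A =
  ∀ (B : Class) → Hereditary B → ChiBounded B → ChiBounded (A ⊓ B)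

-- Cycle of length suc m (≥ 3 required separately): injective map
-- Fin (suc m) → V G with consecutive (cyclically) vertices adjacent.
HasCycle : Graph → ℕ → Set
HasCycle G zero = ⊥
HasCycle G (suc m) =
  Σ (Fin (suc m) → V G) λ c → Injective _≡_ _≡_ c ×
    (∀ i j → (suc (toℕ i) ≡ toℕ j ⊎ (toℕ i ≡ m × toℕ j ≡ 0)) → Edge G (c i) (c j))

GirthAtLeast : ℕ → Graph → Set
GirthAtLeast g G = ∀ ℓ → 3 ≤ ℓ → ℓ < g → ¬ HasCycle G ℓ

-- K is (isomorphic to) the line graph L(G): a bijection between V(K) and
-- E(G) (edges represented as pairs (a , b) with a < b) such that two
-- distinct vertices of K are adjacent iff the edges share an endpoint.
ShareEnd : ∀ {m} → (Fin m × Fin m) → (Fin m × Fin m) → Set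
ShareEnd (a , b) (c , d) = (a ≡ c ⊎ a ≡ d) ⊎ (b ≡ c ⊎ b ≡ d)

IsLineGraphOf : Graph → Graph → Set
IsLineGraphOf K G =
  Σ (V K → V G × V G) λ e →
    (∀ x → toℕ (proj₁ (e x)) < toℕ (proj₂ (e x)) × Edge G (proj₁ (e x)) (proj₂ (e x))) ×
    Injective _≡_ _≡_ e ×
    (∀ a b → toℕ a < toℕ b → Edge G a b → ∃[ x ] e x ≡ (a , b)) ×
    (∀ x y → x ≢ y → (Edge K x y ⇔ ShareEnd (e x) (e y)))

LineGraphs : Class
LineGraphs K = ∃[ G ] IsLineGraphOf K G

LineGraphsOfGirth : ℕ → Class
LineGraphsOfGirth g K = ∃[ G ] (GirthAtLeast g G × IsLineGraphOf K G)

{-# OPTIONS --safe #-}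
-- Let G have girth at least g and no proper 2^k-colouring, and read each edge ab of G with
-- a < b as the interval [a, b). Intersecting the line graph L(G) with the disjointness graph of
-- these intervals, a co-interval graph, leaves the shift graph of G, where ab ~ bc. Co-interval
-- graphs are comparability graphs, hence χ-bounded by Mirsky's theorem, and the shift graph is
-- triangle-free; but a k-colouring of the shift graph would give G the proper 2^k-colouring
-- "v ↦ set of colours of the edges starting at v". The graphs G are built constructively as
-- 2-uniform hypergraphs of large girth in which every colouring has a monochromatic edge, by the
-- partite amalgamation of Nešetřil and Rödl.
module Submission where

open import Defs hiding (sym)
open import Data.Nat as ℕ using (ℕ; zero; suc; _+_; _*_; _^_; _≤_; _<_; s≤s; z≤n)
import Data.Nat.Properties as ℕ
open import Data.Fin as Fin using (Fin; toℕ; fromℕ; inject₁; inject≤; funToFin; finToFun)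
  renaming (suc to sucF)
open import Data.Fin.Patterns using (0F; 1F; 2F)
import Data.Fin.Properties as Fin
open import Data.Bool using (true)
import Data.Bool
open import Data.Product using (Σ; ∃; ∃-syntax; _×_; _,_; proj₁; proj₂; map₂)
import Data.Product
open import Data.Sum using (_⊎_; inj₁; inj₂)
import Data.Sum
open import Data.Sum.Properties using (inj₁-injective; inj₂-injective)
open import Data.Empty using (⊥; ⊥-elim)
open import Data.Unit using (⊤; tt)
open import Data.List using (List; []; _∷_; map; length; filter; lookup; allFin; tabulate; cartesianProduct)
import Data.List.Properties as List
open import Data.List.Membership.Propositional using (_∈_)
import Data.List.Membership.Propositional.Properties as ∈
open import Data.List.Relation.Unary.Any using (here; there)
import Data.List.Relation.Unary.Any as Any
import Data.List.Relation.Unary.Any.Properties as Any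
open import Data.List.Relation.Unary.All as All using (All; []; _∷_)
import Data.List.Relation.Unary.All.Properties as All
open import Data.List.Relation.Unary.AllPairs as AllPairs using (AllPairs; []; _∷_)
import Data.List.Relation.Unary.AllPairs.Properties as AllPairsₚ
open import Data.List.Relation.Unary.Unique.Propositional using (Unique)
import Data.List.Relation.Unary.Unique.Propositional.Properties as Unique
open import Data.List.Relation.Binary.Sublist.Propositional using (_⊆_; []; _∷_; _∷ʳ_)
import Data.List.Relation.Binary.Sublist.Propositional.Properties as Sublist
open import Data.Sum.Function.Propositional using (_⊎-↔_)
open import Data.Product.Function.NonDependent.Propositional using (_×-↔_)
open import Function using (_∘_; id)
open import Function.Bundles using (_↔_; Inverse; Injection; mk⇔)
open import Function.Definitions using (Injective)
open import Function.Properties.Inverse using (↔-refl; ↔-trans; ↔-sym; ↔⇒↣)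
open import Relation.Binary using (DecidableEquality; tri<; tri≈; tri>)
open import Relation.Binary.PropositionalEquality
  using (_≡_; _≢_; refl; sym; trans; cong; cong₂; subst; subst₂)
open import Relation.Nullary using (¬_; Dec; yes; no; does; contradiction)
open import Relation.Nullary.Decidable
  using (map′; via-injection; ¬?; _→-dec_; _×-dec_; _⊎-dec_; does-⇔; dec-true; dec-false)
open import Relation.Unary using (Decidable)

-- Finite types and the pigeonhole principle

record Finite (A : Set) : Set where
  field
    size : ℕ
    enum : A ↔ Fin size

  index : A → Fin size
  index = Inverse.to enum

  element : Fin size → A
  element = Inverse.from enum

  index-injective : Injective _≡_ _≡_ index
  index-injective = Injection.injective (↔⇒↣ enum)

  element-index : ∀ x → element (index x) ≡ x
  element-index = Inverse.strictlyInverseʳ enum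

  element-injective : Injective _≡_ _≡_ element
  element-injective {x} {y} eq =
    trans (sym (Inverse.strictlyInverseˡ enum x)) (trans (cong index eq) (Inverse.strictlyInverseˡ enum y))

  _≟_ : DecidableEquality A
  _≟_ = via-injection (↔⇒↣ enum) Fin._≟_

  elements : List A
  elements = map element (allFin size)

  ∈-elements : ∀ x → x ∈ elements
  ∈-elements x = subst (_∈ elements) (element-index x) (∈.∈-map⁺ element (∈.∈-allFin (index x)))

  any? : ∀ {P : A → Set} → Decidable P → Dec (∃ P)
  any? {P} P? = map′ (λ (i , pi) → element i , pi) (λ (x , px) → index x , subst P (sym (element-index x)) px)
                     (Fin.any? (P? ∘ element))

finite-Fin : ∀ n → Finite (Fin n)
finite-Fin n = record { size = n ; enum = ↔-refl }

finite-⊎ : ∀ {A B} → Finite A → Finite B → Finite (A ⊎ B)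
finite-⊎ a b = record
  { size = Finite.size a + Finite.size b
  ; enum = ↔-trans (Finite.enum a ⊎-↔ Finite.enum b) (↔-sym Fin.+↔⊎)
  }

finite-× : ∀ {A B} → Finite A → Finite B → Finite (A × B)
finite-× a b = record
  { size = Finite.size a * Finite.size b
  ; enum = ↔-trans (Finite.enum a ×-↔ Finite.enum b) (↔-sym Fin.*↔×)
  }

AllPairs-resp-⊆ : ∀ {A : Set} {R : A → A → Set} {xs ys : List A} → xs ⊆ ys → AllPairs R ys → AllPairs R xs
AllPairs-resp-⊆ [] [] = []
AllPairs-resp-⊆ (_ ∷ʳ τ) (_ ∷ rys) = AllPairs-resp-⊆ τ rys
AllPairs-resp-⊆ (refl ∷ τ) (ry ∷ rys) = Sublist.All-resp-⊆ τ ry ∷ AllPairs-resp-⊆ τ rys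

Unique⇒lookup-injective : ∀ {A : Set} {xs : List A} → Unique xs → Injective _≡_ _≡_ (lookup xs)
Unique⇒lookup-injective {xs = _ ∷ _} (_ ∷ _) {0F} {0F} _ = refl
Unique⇒lookup-injective {xs = _ ∷ _} (x∉xs ∷ _) {0F} {sucF j} eq = contradiction eq (All.lookup x∉xs (∈.∈-lookup j))
Unique⇒lookup-injective {xs = _ ∷ _} (x∉xs ∷ _) {sucF i} {0F} eq = contradiction (sym eq) (All.lookup x∉xs (∈.∈-lookup i))
Unique⇒lookup-injective {xs = _ ∷ _} (_ ∷ u) {sucF i} {sucF j} eq = cong sucF (Unique⇒lookup-injective u eq)

module _ {A C : Set} (_≟ᶜ_ : DecidableEquality C) (colour : A → C) where

  colourClass : C → List A → List A
  colourClass γ = filter (λ x → colour x ≟ᶜ γ)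

  length-split : ∀ γ xs → length (colourClass γ xs) + length (filter (λ x → ¬? (colour x ≟ᶜ γ)) xs) ≡ length xs
  length-split γ [] = refl
  length-split γ (x ∷ xs) with colour x ≟ᶜ γ
  ... | yes _ = cong suc (length-split γ xs)
  ... | no _ = trans (ℕ.+-suc _ _) (cong suc (length-split γ xs))

  largeColourClass : ∀ p (cs : List C) (xs : List A) → All (λ x → colour x ∈ cs) xs →
    length cs * p < length xs → ∃[ γ ] p < length (colourClass γ xs)
  largeColourClass p [] (x ∷ _) (() ∷ _) _
  largeColourClass p (γ ∷ cs) xs xs∈ p+cs*p<xs with p ℕ.<? length (colourClass γ xs)
  ... | yes large = γ , large
  ... | no small =
    let γ′ , large = largeColourClass p cs rest rest∈ cs*p<rest
    in γ′ , ℕ.<-≤-trans large (Sublist.length-mono-≤ (Sublist.filter⁺ _ _ (λ { refl → id }) (Sublist.filter-⊆ _ xs)))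
    where
    rest = filter (λ x → ¬? (colour x ≟ᶜ γ)) xs
    rest∈ : All (λ x → colour x ∈ cs) rest
    rest∈ = All.zipWith (λ { (here eq , ne) → contradiction eq ne ; (there x∈ , _) → x∈ })
              (All.filter⁺ _ xs∈ , All.all-filter _ xs)
    cs*p<rest : length cs * p < length rest
    cs*p<rest = ℕ.+-cancelˡ-< p _ _ (ℕ.<-≤-trans p+cs*p<xs (subst (_≤ p + length rest) (length-split γ xs)
                  (ℕ.+-monoˡ-≤ (length rest) (ℕ.≮⇒≥ small))))

pigeonhole : ∀ {k p M} (colour : Fin M → Fin k) → k * p < M →
  ∃[ γ ] Σ (Fin p → Fin M) λ g → Injective _≡_ _≡_ g × ∀ q → colour (g q) ≡ γ
pigeonhole {k} {p} {M} colour kp<M =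
  γ , g , g-injective , λ q → All.lookup (All.all-filter _ (allFin M)) (∈.∈-lookup (at q))
  where
  kp<length : length (allFin k) * p < length (allFin M)
  kp<length = subst₂ (λ a b → a * p < b) (sym (List.length-tabulate {n = k} id)) (sym (List.length-tabulate {n = M} id)) kp<M
  found = largeColourClass Fin._≟_ colour p (allFin k) (allFin M) (All.tabulate⁺ (∈.∈-allFin ∘ colour)) kp<length
  γ = proj₁ found
  p≤ = ℕ.<⇒≤ (proj₂ found)
  at : Fin p → Fin (length (colourClass Fin._≟_ colour γ (allFin M)))
  at q = inject≤ q p≤
  g = lookup (colourClass Fin._≟_ colour γ (allFin M)) ∘ at
  g-injective : Injective _≡_ _≡_ g
  g-injective eq = Fin.inject≤-injective p≤ p≤ _ _
    (Unique⇒lookup-injective (Unique.filter⁺ _ (Unique.allFin⁺ M)) eq)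

-- Hypergraphs and their cycles

record Hypergraph (p : ℕ) : Set₁ where
  field
    Vertex Hyperedge : Set
    vertex-finite : Finite Vertex
    edge-finite : Finite Hyperedge
    vertex : Hyperedge → Fin p → Vertex
    vertex-injective : ∀ N → Injective _≡_ _≡_ (vertex N)

  _∈ₑ_ : Vertex → Hyperedge → Set
  v ∈ₑ N = ∃[ q ] vertex N q ≡ v

NotColorable : ∀ {p} → Hypergraph p → ℕ → Set
NotColorable H k = ∀ (c : Hypergraph.Vertex H → Fin k) → ∃[ N ] ∃[ γ ] ∀ q → c (Hypergraph.vertex H N q) ≡ γ

NotColorable-pred : ∀ {p k} {H : Hypergraph (suc p)} → NotColorable H (suc k) → NotColorable H k
NotColorable-pred {H = H} notColorable c =
  let N , γ , mono = notColorable (inject₁ ∘ c)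
  in N , c (Hypergraph.vertex H N 0F) , λ q → Fin.inject₁-injective (trans (mono q) (sym (mono 0F)))

-- A list of steps (v₀ , N₀) ∷ … ∷ (vₘ , Nₘ) with closing edge γ describes the walk
-- N₀ v₀ N₁ v₁ … Nₘ vₘ γ, so each vᵢ lies on the edge of its own step and on the next one.
module Walks {V E : Set} (_∈_ : V → E → Set) where

  next : E → List (V × E) → E
  next γ [] = γ
  next _ ((_ , N) ∷ _) = N

  Linked : E → List (V × E) → Set
  Linked γ [] = ⊤
  Linked γ ((v , N) ∷ L) = v ∈ N × v ∈ next γ L × Linked γ L

  Alternating : E → List (V × E) → Set
  Alternating γ [] = ⊤
  Alternating γ ((_ , N) ∷ L) = N ≢ next γ L × Alternating γ L

  record ClosedWalk : Set where
    field
      start : E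
      steps : List (V × E)
      linked : Linked start steps
      closed : next start steps ≡ start
      distinct : AllPairs _≢_ (map proj₁ steps)

  record Cycle : Set where
    field
      walk : ClosedWalk
      alternating : Alternating (ClosedWalk.start walk) (ClosedWalk.steps walk)
      nonempty : 0 < length (ClosedWalk.steps walk)

    open ClosedWalk walk public

  next-constant : ∀ {γ} L → All (λ s → proj₂ s ≡ γ) L → next γ L ≡ γ
  next-constant [] [] = refl
  next-constant (_ ∷ _) (N≡γ ∷ _) = N≡γ

  path : ∀ {m} → (Fin (suc m) → V) → (Fin m → E) → List (V × E)
  path u e = tabulate λ i → u (sucF i) , e i

  path-linked : ∀ {m} (u : Fin (suc m) → V) (e : Fin m → E) γ →
    (∀ i → u (inject₁ i) ∈ e i) → (∀ i → u (sucF i) ∈ e i) → u (fromℕ m) ∈ γ →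
    u 0F ∈ next γ (path u e) × Linked γ (path u e)
  path-linked {zero} u e γ _ _ u∈γ = u∈γ , tt
  path-linked {suc m} u e γ u∈e u∈e′ u∈γ =
    u∈e 0F , u∈e′ 0F , path-linked (u ∘ sucF) (e ∘ sucF) γ (u∈e ∘ sucF) (u∈e′ ∘ sucF) u∈γ

  module _ (_≟_ : DecidableEquality E) where

    dropStutters : E → List (V × E) → List (V × E)
    dropStutters γ [] = []
    dropStutters γ ((v , N) ∷ L) with N ≟ next γ L
    ... | yes _ = dropStutters γ L
    ... | no _ = (v , N) ∷ dropStutters γ L

    dropStutters-next : ∀ γ L → next γ (dropStutters γ L) ≡ next γ L
    dropStutters-next γ [] = refl
    dropStutters-next γ ((v , N) ∷ L) with N ≟ next γ L
    ... | yes N≡next = trans (dropStutters-next γ L) (sym N≡next)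
    ... | no _ = refl

    dropStutters-linked : ∀ γ L → Linked γ L → Linked γ (dropStutters γ L)
    dropStutters-linked γ [] _ = tt
    dropStutters-linked γ ((v , N) ∷ L) (v∈N , v∈next , linked) with N ≟ next γ L
    ... | yes _ = dropStutters-linked γ L linked
    ... | no _ = v∈N , subst (v ∈_) (sym (dropStutters-next γ L)) v∈next , dropStutters-linked γ L linked

    dropStutters-alternating : ∀ γ L → Alternating γ (dropStutters γ L)
    dropStutters-alternating γ [] = tt
    dropStutters-alternating γ ((v , N) ∷ L) with N ≟ next γ L
    ... | yes _ = dropStutters-alternating γ L
    ... | no N≢next = (λ N≡ → N≢next (trans N≡ (dropStutters-next γ L))) , dropStutters-alternating γ L

    dropStutters-⊆ : ∀ γ L → dropStutters γ L ⊆ L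
    dropStutters-⊆ γ [] = []
    dropStutters-⊆ γ ((v , N) ∷ L) with N ≟ next γ L
    ... | yes _ = (v , N) ∷ʳ dropStutters-⊆ γ L
    ... | no _ = refl ∷ dropStutters-⊆ γ L

    dropStutters-shorter-or-alternating : ∀ γ L → length (dropStutters γ L) < length L ⊎ Alternating γ L
    dropStutters-shorter-or-alternating γ [] = inj₂ tt
    dropStutters-shorter-or-alternating γ ((v , N) ∷ L) with N ≟ next γ L
    ... | yes _ = inj₁ (s≤s (Sublist.length-mono-≤ (dropStutters-⊆ γ L)))
    ... | no N≢next with dropStutters-shorter-or-alternating γ L
    ...   | inj₁ shorter = inj₁ (s≤s shorter)
    ...   | inj₂ alternating = inj₂ (N≢next , alternating)

    dropStutters-[] : ∀ γ L → dropStutters γ L ≡ [] → All (λ s → proj₂ s ≡ γ) L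
    dropStutters-[] γ [] _ = []
    dropStutters-[] γ ((v , N) ∷ L) empty with N ≟ next γ L
    ... | yes N≡next = let constant = dropStutters-[] γ L empty in trans N≡next (next-constant L constant) ∷ constant
    ... | no _ with () ← empty

    shortcut : ClosedWalk → ClosedWalk
    shortcut W = record
      { start = start
      ; steps = dropStutters start steps
      ; linked = dropStutters-linked start steps linked
      ; closed = trans (dropStutters-next start steps) closed
      ; distinct = AllPairs-resp-⊆ (Sublist.map⁺ proj₁ (dropStutters-⊆ start steps)) distinct
      }
      where open ClosedWalk W

    shortcutCycle : (W : ClosedWalk) → ¬ All (λ s → proj₂ s ≡ ClosedWalk.start W) (ClosedWalk.steps W) → Cycle
    shortcutCycle W nonconstant = record
      { walk = shortcut W
      ; alternating = dropStutters-alternating start steps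
      ; nonempty = nonempty (dropStutters start steps) (nonconstant ∘ dropStutters-[] start steps)
      }
      where
      open ClosedWalk W
      nonempty : ∀ (L : List (V × E)) → L ≢ [] → 0 < length L
      nonempty [] L≢[] = contradiction refl L≢[]
      nonempty (_ ∷ _) _ = s≤s z≤n

cycleLength : ∀ {V E} {_∈_ : V → E → Set} → Walks.Cycle _∈_ → ℕ
cycleLength C = length (Walks.Cycle.steps C)

module _ {V₀ E₀ V E : Set} {_∈₀_ : V₀ → E₀ → Set} {_∈_ : V → E → Set}
         (f : V₀ → V) (g : E₀ → E) (g-injective : Injective _≡_ _≡_ g)
         (split : ∀ {v N N′} → v ∈ g N → v ∈ g N′ → g N ≢ g N′ → ∃[ z ] f z ≡ v × z ∈₀ N × z ∈₀ N′)
  where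
  private
    module W₀ = Walks _∈₀_
    module W = Walks _∈_
    F = Data.Product.map f g

  next-map : ∀ γ₀ Z → W.next (g γ₀) (map F Z) ≡ g (W₀.next γ₀ Z)
  next-map γ₀ [] = refl
  next-map γ₀ (_ ∷ _) = refl

  lift : ∀ γ₀ L → W.Linked (g γ₀) L → W.Alternating (g γ₀) L → All (λ s → ∃[ N ] g N ≡ proj₂ s) L →
    Σ (List (V₀ × E₀)) λ Z → map F Z ≡ L × W₀.Linked γ₀ Z × W₀.Alternating γ₀ Z
  lift γ₀ [] _ _ [] = [] , refl , tt , tt
  lift γ₀ ((v , _) ∷ L) (v∈N , v∈next , linked) (N≢next , alternating) ((N , refl) ∷ preimages)
    with lift γ₀ L linked alternating preimages
  ... | Z , refl , linkedZ , alternatingZ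
    with split v∈N (subst (v ∈_) (next-map γ₀ Z) v∈next) (λ eq → N≢next (trans eq (sym (next-map γ₀ Z))))
  ...   | z , refl , z∈N , z∈next =
    (z , N) ∷ Z , refl , (z∈N , z∈next , linkedZ) ,
    ((λ eq → N≢next (trans (cong g eq) (sym (next-map γ₀ Z)))) , alternatingZ)

  preimage-of-start : ∀ {γ} L → W.next γ L ≡ γ → 0 < length L → All (λ s → ∃[ N ] g N ≡ proj₂ s) L →
    ∃[ N ] g N ≡ γ
  preimage-of-start (_ ∷ _) closed _ ((N , gN≡) ∷ _) = N , trans gN≡ closed

  liftCycle : (C : W.Cycle) → All (λ s → ∃[ N ] g N ≡ proj₂ s) (W.Cycle.steps C) →
    Σ W₀.Cycle λ C₀ → cycleLength C₀ ≡ cycleLength C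
  liftCycle record { walk = record { steps = L ; linked = linked ; closed = closed ; distinct = distinct }
                   ; alternating = alternating ; nonempty = nonempty } preimages
    with preimage-of-start L closed nonempty preimages
  ... | γ₀ , refl with lift γ₀ L linked alternating preimages
  ... | Z , refl , linkedZ , alternatingZ = C₀ , sym (List.length-map F Z)
    where
    C₀ : W₀.Cycle
    C₀ = record
      { walk = record
        { start = γ₀ ; steps = Z ; linked = linkedZ
        ; closed = g-injective (trans (sym (next-map γ₀ Z)) closed)
        ; distinct = AllPairsₚ.map⁺ (AllPairs.map (λ f≢ eq → f≢ (cong f eq))
                       (AllPairsₚ.map⁻ (subst (AllPairs _≢_) (sym (List.map-∘ Z)) distinct))) }
      ; alternating = alternatingZ
      ; nonempty = subst (0 <_) (List.length-map F Z) nonempty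
      }

module _ {V E E′ : Set} {_∈_ : V → E → Set} {_∈′_ : V → E′ → Set}
         (h : E → E′) (h-∈ : ∀ {v N} → v ∈ N → v ∈′ h N)
  where
  private
    module W = Walks _∈_
    module W′ = Walks _∈′_

  next-map₂ : ∀ γ L → W′.next (h γ) (map (map₂ h) L) ≡ h (W.next γ L)
  next-map₂ γ [] = refl
  next-map₂ γ (_ ∷ _) = refl

  linked-map₂ : ∀ γ L → W.Linked γ L → W′.Linked (h γ) (map (map₂ h) L)
  linked-map₂ γ [] _ = tt
  linked-map₂ γ ((v , N) ∷ L) (v∈N , v∈next , linked) =
    h-∈ v∈N , subst (v ∈′_) (sym (next-map₂ γ L)) (h-∈ v∈next) , linked-map₂ γ L linked

  projectWalk : W.ClosedWalk → W′.ClosedWalk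
  projectWalk W = record
    { start = h start
    ; steps = map (map₂ h) steps
    ; linked = linked-map₂ start steps linked
    ; closed = trans (next-map₂ start steps) (cong h closed)
    ; distinct = subst (AllPairs _≢_) (List.map-∘ steps) distinct
    }
    where open W.ClosedWalk W

CycleIn : ∀ {p} → Hypergraph p → Set
CycleIn H = Walks.Cycle (Hypergraph._∈ₑ_ H)

GirthAbove : ∀ {p} → ℕ → Hypergraph p → Set
GirthAbove ℓ H = (C : CycleIn H) → ℓ < cycleLength C

-- Hypergraphs of large girth and chromatic number

module Complete {p M : ℕ} (p≤M : p ≤ M) where

  injective? : (f : Fin p → Fin M) → Dec (∀ i j → f i ≡ f j → i ≡ j)
  injective? f = Fin.all? λ i → Fin.all? λ j → (f i Fin.≟ f j) →-dec (i Fin.≟ j)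

  -- Edges are indexed by all maps Fin p → Fin M; a non-injective one is replaced by the
  -- inclusion, which only duplicates an edge.
  orInclusion : (Fin p → Fin M) → Fin p → Fin M
  orInclusion f with injective? f
  ... | yes _ = f
  ... | no _ = λ q → inject≤ q p≤M

  orInclusion-injective : ∀ f → Injective _≡_ _≡_ (orInclusion f)
  orInclusion-injective f with injective? f
  ... | yes f-injective = f-injective _ _
  ... | no _ = Fin.inject≤-injective p≤M p≤M _ _

  orInclusion-≗ : ∀ f → (∀ i j → f i ≡ f j → i ≡ j) → ∀ q → orInclusion f q ≡ f q
  orInclusion-≗ f f-injective q with injective? f
  ... | yes _ = refl
  ... | no not-injective = contradiction f-injective not-injective

  complete : Hypergraph p
  complete = record
    { Vertex = Fin M ; Hyperedge = Fin (M ^ p)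
    ; vertex-finite = finite-Fin M ; edge-finite = finite-Fin (M ^ p)
    ; vertex = orInclusion ∘ finToFun ; vertex-injective = orInclusion-injective ∘ finToFun
    }

  complete-notColorable : ∀ {k} → k * p < M → NotColorable complete k
  complete-notColorable kp<M c with pigeonhole c kp<M
  ... | γ , g , g-injective , mono = funToFin g , γ , λ q → trans (cong c (vertex≗g q)) (mono q)
    where
    decode = Fin.finToFun-funToFin g
    vertex≗g : ∀ q → orInclusion (finToFun (funToFin g)) q ≡ g q
    vertex≗g q = trans (orInclusion-≗ _ (λ i j eq → g-injective (trans (sym (decode i)) (trans eq (decode j)))) q)
                       (decode q)

module PartiteConstruction {p : ℕ} (G : Hypergraph p) where
  private
    module G = Hypergraph G
    Part = G.Vertex
    _≟ₚ_ = Finite._≟_ G.vertex-finite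

  -- A vertex (j , x) lies in the part of the vertex j of G, and each edge E is a copy of the
  -- edge label E of G.
  record Partite : Set₁ where
    field
      Fibre Hyperedge : Set
      fibre-finite : Finite Fibre
      edge-finite : Finite Hyperedge
      label : Hyperedge → G.Hyperedge
      position : Hyperedge → Fin p → Fibre

    vertexₚ : Hyperedge → Fin p → Part × Fibre
    vertexₚ E q = G.vertex (label E) q , position E q

  toHypergraph : Partite → Hypergraph p
  toHypergraph P = record
    { Vertex = Part × Fibre ; Hyperedge = Partite.Hyperedge P
    ; vertex-finite = finite-× G.vertex-finite fibre-finite ; edge-finite = edge-finite
    ; vertex = vertexₚ ; vertex-injective = λ E eq → G.vertex-injective (label E) (cong proj₁ eq)
    }
    where open Partite P

  module _ (P : Partite) where
    open Partite P
    open Hypergraph (toHypergraph P) using (_∈ₑ_)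

    partite : ∀ {E v w} → v ∈ₑ E → w ∈ₑ E → proj₁ v ≡ proj₁ w → v ≡ w
    partite {E} (q , refl) (q′ , refl) same-part with G.vertex-injective (label E) same-part
    ... | refl = refl

  disjointEdges : Partite
  disjointEdges = record
    { Fibre = G.Hyperedge ; Hyperedge = G.Hyperedge
    ; fibre-finite = G.edge-finite ; edge-finite = G.edge-finite
    ; label = id ; position = λ E _ → E
    }

  disjointEdges-girth : ∀ ℓ → GirthAbove ℓ (toHypergraph disjointEdges)
  disjointEdges-girth ℓ record { walk = record { steps = (_ , _) ∷ _ ; linked = ((_ , refl) , (_ , same-edge) , _) }
                               ; alternating = (N≢next , _) } = contradiction (sym (cong proj₂ same-edge)) N≢next

  -- A section τ of label is a copy of G inside P.
  HomogeneousCopies : ℕ → List Part → Partite → Set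
  HomogeneousCopies k js P = ∀ (c : Part × Fibre → Fin (suc k)) →
    Σ (G.Hyperedge → Hyperedge) λ τ → (∀ E → label (τ E) ≡ E) ×
      Σ (Part → Fin (suc k)) λ γ → ∀ E q → let j = G.vertex (label (τ E)) q in j ∈ js → c (j , position (τ E) q) ≡ γ j
    where open Partite P

  disjointEdges-homogeneous : ∀ {k} → HomogeneousCopies k [] disjointEdges
  disjointEdges-homogeneous c = id , (λ _ → refl) , (λ _ → 0F) , λ _ _ ()

  homogeneous⇒notColorable : ∀ {k js} (P : Partite) → HomogeneousCopies k js P → (∀ j → j ∈ js) →
    NotColorable G (suc k) → NotColorable (toHypergraph P) (suc k)
  homogeneous⇒notColorable P homogeneous all-parts notColorable c with homogeneous c
  ... | τ , τ-label , γ , constant with notColorable γ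
  ...   | E , δ , mono = τ E , δ , λ q →
          trans (constant E q (all-parts _)) (trans (cong (λ E′ → γ (G.vertex E′ q)) (τ-label E)) (mono q))

  -- One copy of P for each edge N of A, the copies glued along part ι: there the fibre of the
  -- copy N is identified with the edge N of A.
  module Amalgamation (P : Partite) (ι : Part) (A : Hypergraph (Finite.size (Partite.fibre-finite P))) where
    private
      module P = Partite P
      module A = Hypergraph A

    glue : A.Hyperedge → Part → P.Fibre → A.Vertex ⊎ (A.Hyperedge × P.Fibre)
    glue N j x with j ≟ₚ ι
    ... | yes _ = inj₁ (A.vertex N (Finite.index P.fibre-finite x))
    ... | no _ = inj₂ (N , x)

    amalgamate : Partite
    amalgamate = record
      { Fibre = A.Vertex ⊎ (A.Hyperedge × P.Fibre) ; Hyperedge = A.Hyperedge × P.Hyperedge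
      ; fibre-finite = finite-⊎ A.vertex-finite (finite-× A.edge-finite P.fibre-finite)
      ; edge-finite = finite-× A.edge-finite P.edge-finite
      ; label = P.label ∘ proj₂
      ; position = λ (N , E) q → glue N (G.vertex (P.label E) q) (P.position E q)
      }

    copy : A.Hyperedge → Part × P.Fibre → Part × (A.Vertex ⊎ (A.Hyperedge × P.Fibre))
    copy N (j , x) = j , glue N j x

    glue-ι : ∀ N {j} x → j ≡ ι → glue N j x ≡ inj₁ (A.vertex N (Finite.index P.fibre-finite x))
    glue-ι N {j} x j≡ι with j ≟ₚ ι
    ... | yes _ = refl
    ... | no j≢ι = contradiction j≡ι j≢ι

    glue-≢ : ∀ N {j} x → j ≢ ι → glue N j x ≡ inj₂ (N , x)
    glue-≢ N {j} x j≢ι with j ≟ₚ ι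
    ... | yes j≡ι = contradiction j≡ι j≢ι
    ... | no _ = refl

    glue-injective : ∀ N j → Injective _≡_ _≡_ (glue N j)
    glue-injective N j {x} {y} eq = by-part (j ≟ₚ ι)
      where
      by-part : Dec (j ≡ ι) → x ≡ y
      by-part (yes j≡ι) = Finite.index-injective P.fibre-finite
        (A.vertex-injective N (inj₁-injective (trans (sym (glue-ι N x j≡ι)) (trans eq (glue-ι N y j≡ι)))))
      by-part (no j≢ι) = cong proj₂ (inj₂-injective (trans (sym (glue-≢ N x j≢ι)) (trans eq (glue-≢ N y j≢ι))))

    copy-injective : ∀ N → Injective _≡_ _≡_ (copy N)
    copy-injective N {j , x} {j′ , y} eq with refl ← cong proj₁ eq = cong (j ,_) (glue-injective N j (cong proj₂ eq))

    amalgamate-homogeneous : ∀ {k js} → HomogeneousCopies k js P → NotColorable A (suc k) →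
      HomogeneousCopies k (ι ∷ js) amalgamate
    amalgamate-homogeneous {k} {js} homogeneous notColorable c with notColorable (λ z → c (ι , inj₁ z))
    ... | N , δ , mono with homogeneous (c ∘ copy N)
    ...   | τ , τ-label , γ , constant = (N ,_) ∘ τ , τ-label , γ′ , constant′
      where
      choose : ∀ j → Dec (j ≡ ι) → Fin (suc k)
      choose j (yes _) = δ
      choose j (no _) = γ j
      γ′ : Part → Fin (suc k)
      γ′ j = choose j (j ≟ₚ ι)
      constant′ : ∀ E q → let j = G.vertex (P.label (τ E)) q in
        j ∈ ι ∷ js → c (j , glue N j (P.position (τ E) q)) ≡ γ′ j
      constant′ E q j∈ = by-part (j ≟ₚ ι) j∈
        where
        j = G.vertex (P.label (τ E)) q
        x = P.position (τ E) q
        by-part : (d : Dec (j ≡ ι)) → j ∈ ι ∷ js → c (j , glue N j x) ≡ choose j d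
        by-part (yes refl) _ = trans (cong (λ y → c (ι , y)) (glue-ι N x refl)) (mono _)
        by-part (no j≢ι) (here j≡ι) = contradiction j≡ι j≢ι
        by-part (no j≢ι) (there j∈js) = constant E q j∈js

    private
      _∈ᴾ_ = Hypergraph._∈ₑ_ (toHypergraph P)
      _∈′_ = Hypergraph._∈ₑ_ (toHypergraph amalgamate)
      _≟ᴬ_ = Finite._≟_ A.edge-finite
      module W′ = Walks _∈′_

    _∈ᶜ_ : Part × (A.Vertex ⊎ (A.Hyperedge × P.Fibre)) → A.Hyperedge → Set
    v ∈ᶜ N = ∃[ E ] v ∈′ (N , E)

    private
      module Wᶜ = Walks _∈ᶜ_

    copies-split : ∀ {v N N′} → v ∈ᶜ N → v ∈ᶜ N′ → N ≢ N′ →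
      ∃[ z ] (ι , inj₁ z) ≡ v × A._∈ₑ_ z N × A._∈ₑ_ z N′
    copies-split {N = N} {N′} (E , q , refl) (E′ , q′ , eq) N≢N′ = by-part (j ≟ₚ ι)
      where
      j = G.vertex (P.label E) q
      x = P.position E q
      x′ = P.position E′ q′
      by-part : Dec (j ≡ ι) → ∃[ z ] (ι , inj₁ z) ≡ (j , glue N j x) × A._∈ₑ_ z N × A._∈ₑ_ z N′
      by-part (yes j≡ι) =
        A.vertex N (index x) , cong₂ _,_ (sym j≡ι) (sym (glue-ι N x j≡ι)) , (index x , refl) ,
        (index x′ , inj₁-injective (trans (sym (glue-ι N′ x′ (trans (cong proj₁ eq) j≡ι)))
                                          (trans (cong proj₂ eq) (glue-ι N x j≡ι))))
        where index = Finite.index P.fibre-finite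
      by-part (no j≢ι) = contradiction
        (cong proj₁ (inj₂-injective (trans (sym (glue-≢ N′ x′ (j≢ι ∘ trans (sym (cong proj₁ eq)))))
                                           (trans (cong proj₂ eq) (glue-≢ N x j≢ι)))))
        (N≢N′ ∘ sym)

    copy-split : ∀ {N₀ v E E′} → v ∈′ (N₀ , E) → v ∈′ (N₀ , E′) → (N₀ , E) ≢ (N₀ , E′) →
      ∃[ z ] copy N₀ z ≡ v × z ∈ᴾ E × z ∈ᴾ E′
    copy-split {N₀} (q , refl) (q′ , eq) _ = P.vertexₚ _ q , refl , (q , refl) , (q′ , copy-injective N₀ eq)

    in-copy : ∀ {v N} → v ∈′ N → v ∈ᶜ proj₁ N
    in-copy {N = N} v∈N = proj₂ N , v∈N

    copyWalk : W′.ClosedWalk → Wᶜ.ClosedWalk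
    copyWalk = projectWalk proj₁ in-copy

    alternating-copies⇒⊥ : (C : W′.Cycle) →
      Wᶜ.Alternating (proj₁ (W′.Cycle.start C)) (map (map₂ proj₁) (W′.Cycle.steps C)) → ⊥
    alternating-copies⇒⊥ record { walk = record { steps = _ ∷ [] ; closed = refl } } (N≢N , _) = N≢N refl
    alternating-copies⇒⊥ record { walk = record
                                   { start = γ ; steps = (v₀ , N₀ , E₀) ∷ (v₁ , N₁ , E₁) ∷ L
                                   ; linked = v₀∈₀ , v₀∈₁ , v₁∈₁ , v₁∈next , _
                                   ; distinct = (v₀≢v₁ ∷ _) ∷ _ } }
                         (N₀≢N₁ , N₁≢next , _) =
      v₀≢v₁ (partite amalgamate v₀∈₁ v₁∈₁ (trans (cong proj₁ (sym ι≡v₀)) (cong proj₁ ι≡v₁)))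
      where
      ι≡v₀ = proj₁ (proj₂ (copies-split (E₀ , v₀∈₀) (E₁ , v₀∈₁) N₀≢N₁))
      ι≡v₁ = proj₁ (proj₂ (copies-split (E₁ , v₁∈₁) (_ , v₁∈next)
               (N₁≢next ∘ (λ eq → trans eq (sym (next-map₂ {_∈_ = _∈′_} {_∈′_ = _∈ᶜ_} proj₁ in-copy γ L))))))

    -- A cycle inside one copy is a cycle of P. Otherwise its sequence of copies, with repetitions
    -- dropped, is a cycle of A through part ι, strictly shorter unless every step changes copy;
    -- but then two consecutive vertices lie in part ι and on a common edge, so they coincide.
    amalgamate-girth : ∀ {ℓ} → GirthAbove (suc ℓ) (toHypergraph P) → GirthAbove ℓ A →
      GirthAbove (suc ℓ) (toHypergraph amalgamate)
    amalgamate-girth {ℓ} girthP girthA C = by-copies (All.all? (λ s → proj₁ (proj₂ s) ≟ᴬ N₀) steps)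
      where
      open W′.Cycle C
      N₀ = proj₁ start
      by-copies : Dec (All (λ s → proj₁ (proj₂ s) ≡ N₀) steps) → suc ℓ < cycleLength C
      by-copies (yes one-copy) =
        let C₀ , same-length = liftCycle (copy N₀) (N₀ ,_) (cong proj₂) copy-split C
                                 (All.map (λ {s} eq → proj₂ (proj₂ s) , sym (cong (_, proj₂ (proj₂ s)) eq)) one-copy)
        in subst (suc ℓ <_) same-length (girthP C₀)
      by-copies (no several-copies) = by-length (Wᶜ.dropStutters-shorter-or-alternating _≟ᴬ_ N₀ (Wᶜ.ClosedWalk.steps W))
        where
        W = copyWalk walk
        D = Wᶜ.shortcutCycle _≟ᴬ_ W (several-copies ∘ All.map⁻)
        by-length : cycleLength D < length (Wᶜ.ClosedWalk.steps W) ⊎ Wᶜ.Alternating N₀ (Wᶜ.ClosedWalk.steps W) →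
          suc ℓ < cycleLength C
        by-length (inj₁ shorter) =
          let Cᴬ , same-length = liftCycle (λ z → ι , inj₁ z) id id copies-split D (All.universal (λ s → proj₂ s , refl) _)
          in subst (suc ℓ <_) (List.length-map _ steps) (ℕ.≤-trans (s≤s (subst (ℓ <_) same-length (girthA Cᴬ))) shorter)
        by-length (inj₂ alternating) = ⊥-elim (alternating-copies⇒⊥ C alternating)

  module Tower (k ℓ : ℕ) (A : ∀ q → Hypergraph q)
               (A-notColorable : ∀ q → NotColorable (A q) (suc k)) (A-girth : ∀ q → GirthAbove ℓ (A q)) where

    tower : List Part → Partite
    tower [] = disjointEdges
    tower (ι ∷ js) = Amalgamation.amalgamate (tower js) ι (A _)

    tower-homogeneous : ∀ js → HomogeneousCopies k js (tower js)
    tower-homogeneous [] = disjointEdges-homogeneous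
    tower-homogeneous (ι ∷ js) =
      Amalgamation.amalgamate-homogeneous (tower js) ι (A _) (tower-homogeneous js) (A-notColorable _)

    tower-girth : ∀ js → GirthAbove (suc ℓ) (toHypergraph (tower js))
    tower-girth [] = disjointEdges-girth (suc ℓ)
    tower-girth (ι ∷ js) = Amalgamation.amalgamate-girth (tower js) ι (A _) (tower-girth js) (A-girth _)

    allParts : List Part
    allParts = Finite.elements G.vertex-finite

    tower-notColorable : NotColorable G (suc k) → NotColorable (toHypergraph (tower allParts)) (suc k)
    tower-notColorable = homogeneous⇒notColorable (tower allParts) (tower-homogeneous allParts) (Finite.∈-elements G.vertex-finite)

highGirth-notColorable : ∀ ℓ k p → Σ (Hypergraph p) λ H → NotColorable H (suc k) × GirthAbove ℓ H
highGirth-notColorable zero k p = complete , complete-notColorable ℕ.≤-refl , Walks.Cycle.nonempty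
  where open Complete (ℕ.m≤n⇒m≤1+n (ℕ.m≤m+n p (k * p)))
highGirth-notColorable (suc ℓ) k p =
  toHypergraph (tower allParts) , tower-notColorable (complete-notColorable ℕ.≤-refl) , tower-girth allParts
  where
  open Complete (ℕ.m≤n⇒m≤1+n (ℕ.m≤m+n p (k * p)))
  open PartiteConstruction complete
  smaller = highGirth-notColorable ℓ k
  open Tower k ℓ (proj₁ ∘ smaller) (proj₁ ∘ proj₂ ∘ smaller) (proj₂ ∘ proj₂ ∘ smaller)

-- From 2-uniform hypergraphs to graphs

graphOf : ∀ n (R : Fin n → Fin n → Set) → (∀ x y → Dec (R x y)) →
  (∀ {x y} → R x y → R y x) → (∀ {x} → ¬ R x x) → Graph
graphOf n R R? R-sym R-irrefl = record
  { n = n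
  ; adj = λ x y → does (R? x y)
  ; sym = λ x y → does-⇔ (mk⇔ R-sym R-sym) (R? x y) (R? y x)
  ; irrefl = λ x → dec-false (R? x x) R-irrefl
  }

does-true⇒ : ∀ {P : Set} (P? : Dec P) → does P? ≡ true → P
does-true⇒ (yes p) _ = p

module TwoUniform (H : Hypergraph 2) where
  open Hypergraph H
  private
    module V = Finite vertex-finite

  Joins : Hyperedge → Vertex → Vertex → Set
  Joins N u v = vertex N 0F ≡ u × vertex N 1F ≡ v

  Adjacent : Vertex → Vertex → Set
  Adjacent u v = ∃[ N ] (Joins N u v ⊎ Joins N v u)

  adjacent? : ∀ u v → Dec (Adjacent u v)
  adjacent? u v = Finite.any? edge-finite λ N →
    ((vertex N 0F V.≟ u) ×-dec (vertex N 1F V.≟ v)) ⊎-dec ((vertex N 0F V.≟ v) ×-dec (vertex N 1F V.≟ u))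

  toGraph : Graph
  toGraph = graphOf V.size (λ x y → Adjacent (V.element x) (V.element y)) (λ x y → adjacent? _ _)
    (map₂ Data.Sum.swap) (λ { (N , inj₁ (a , b)) → 0≢1 (vertex-injective N (trans a (sym b)))
                            ; (N , inj₂ (a , b)) → 0≢1 (vertex-injective N (trans a (sym b))) })
    where
    0≢1 : 0F ≢ 1F
    0≢1 ()

  atMostTwo : ∀ {N a b c} → a ∈ₑ N → b ∈ₑ N → c ∈ₑ N → a ≡ b ⊎ b ≡ c ⊎ a ≡ c
  atMostTwo (0F , refl) (0F , refl) _ = inj₁ refl
  atMostTwo (1F , refl) (1F , refl) _ = inj₁ refl
  atMostTwo _ (0F , refl) (0F , refl) = inj₂ (inj₁ refl)
  atMostTwo _ (1F , refl) (1F , refl) = inj₂ (inj₁ refl)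
  atMostTwo (0F , refl) _ (0F , refl) = inj₂ (inj₂ refl)
  atMostTwo (1F , refl) _ (1F , refl) = inj₂ (inj₂ refl)

  edge⇒hyperedge : ∀ {x y} → Edge toGraph x y → ∃[ N ] V.element x ∈ₑ N × V.element y ∈ₑ N
  edge⇒hyperedge {x} {y} xy with does-true⇒ (adjacent? (V.element x) (V.element y)) xy
  ... | N , inj₁ (x₀ , y₁) = N , (0F , x₀) , (1F , y₁)
  ... | N , inj₂ (y₀ , x₁) = N , (1F , x₁) , (0F , y₀)

  toGraph-notColorable : ∀ {k} → NotColorable H k → ¬ Colorable toGraph k
  toGraph-notColorable notColorable (c , proper) with notColorable (c ∘ V.index)
  ... | N , γ , mono = proper (V.index (vertex N 0F)) (V.index (vertex N 1F)) adjacent (trans (mono 0F) (sym (mono 1F)))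
    where
    adjacent : Edge toGraph (V.index (vertex N 0F)) (V.index (vertex N 1F))
    adjacent = dec-true (adjacent? _ _) (N , inj₁ (sym (V.element-index _) , sym (V.element-index _)))

  -- Three distinct vertices of the graph cycle keep its closed walk from staying on one edge.
  graphCycle⇒cycle : ∀ m → HasCycle toGraph (3 + m) → Σ (CycleIn H) λ C → cycleLength C ≤ 3 + m
  graphCycle⇒cycle m (c , c-injective , c-adjacent) = D , subst (cycleLength D ≤_) W-length D≤W
    where
    open Walks _∈ₑ_
    u : Fin (3 + m) → Vertex
    u = V.element ∘ c
    u-injective : ∀ {i j} → u i ≡ u j → i ≡ j
    u-injective = c-injective ∘ V.element-injective
    between : ∀ i j → suc (toℕ i) ≡ toℕ j ⊎ (toℕ i ≡ 2 + m × toℕ j ≡ 0) → ∃[ N ] u i ∈ₑ N × u j ∈ₑ N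
    between i j ij = edge⇒hyperedge (c-adjacent i j ij)
    consecutive : ∀ (i : Fin (2 + m)) → ∃[ N ] u (inject₁ i) ∈ₑ N × u (sucF i) ∈ₑ N
    consecutive i = between (inject₁ i) (sucF i) (inj₁ (cong suc (Fin.toℕ-inject₁ i)))
    closing = between (fromℕ (2 + m)) 0F (inj₂ (Fin.toℕ-fromℕ _ , refl))
    γ = proj₁ closing
    e = proj₁ ∘ consecutive
    W : ClosedWalk
    W = record
      { start = γ
      ; steps = (u 0F , γ) ∷ path u e
      ; linked = proj₂ (proj₂ closing) ,
                 path-linked u e γ (proj₁ ∘ proj₂ ∘ consecutive) (proj₂ ∘ proj₂ ∘ consecutive) (proj₁ (proj₂ closing))
      ; closed = refl
      ; distinct = subst (AllPairs _≢_) (sym (cong (u 0F ∷_) (List.map-tabulate (λ i → u (sucF i) , e i) proj₁)))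
                         (Unique.tabulate⁺ u-injective)
      }
    W-length : length (ClosedWalk.steps W) ≡ 3 + m
    W-length = cong suc (List.length-tabulate (λ i → u (sucF i) , e i))
    nonconstant : ¬ All (λ s → proj₂ s ≡ γ) (ClosedWalk.steps W)
    nonconstant (_ ∷ e₀≡γ ∷ e₁≡γ ∷ _) with atMostTwo (proj₂ (proj₂ closing))
                                               (subst (u 1F ∈ₑ_) e₀≡γ (proj₂ (proj₂ (consecutive 0F))))
                                               (subst (u 2F ∈ₑ_) e₁≡γ (proj₂ (proj₂ (consecutive 1F))))
    ... | inj₁ u₀≡u₁ with () ← u-injective u₀≡u₁
    ... | inj₂ (inj₁ u₁≡u₂) with () ← u-injective u₁≡u₂
    ... | inj₂ (inj₂ u₀≡u₂) with () ← u-injective u₀≡u₂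
    D = shortcutCycle (Finite._≟_ edge-finite) W nonconstant
    D≤W : cycleLength D ≤ length (ClosedWalk.steps W)
    D≤W = Sublist.length-mono-≤ (dropStutters-⊆ (Finite._≟_ edge-finite) γ (ClosedWalk.steps W))

  toGraph-girth : ∀ {g} → GirthAbove g H → GirthAtLeast g toGraph
  toGraph-girth girth zero _ _ ()
  toGraph-girth girth (suc zero) (s≤s ()) _ _
  toGraph-girth girth (suc (suc zero)) (s≤s (s≤s ())) _ _
  toGraph-girth girth (suc (suc (suc m))) _ cycle<g cycle =
    let C , C≤cycle = graphCycle⇒cycle m cycle
    in ℕ.<-irrefl refl (ℕ.<-≤-trans (girth C) (ℕ.≤-trans C≤cycle (ℕ.<⇒≤ cycle<g)))

-- Clique number, χ-boundedness and co-interval graphs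

module _ (G : Graph) where

  edge-sym : ∀ {x y} → Edge G x y → Edge G y x
  edge-sym {x} {y} xy = trans (Graph.sym G y x) xy

  edge-irrefl : ∀ {x} → ¬ Edge G x x
  edge-irrefl {x} xx with () ← trans (sym xx) (irrefl G x)

  Pairwise : ∀ {w} → (Fin w → V G) → Set
  Pairwise c = ∀ i j → i ≢ j → Edge G (c i) (c j)

  pairwise⇒injective : ∀ {w} (c : Fin w → V G) → Pairwise c → Injective _≡_ _≡_ c
  pairwise⇒injective c pairwise {i} {j} ci≡cj with i Fin.≟ j
  ... | yes i≡j = i≡j
  ... | no i≢j = contradiction (subst (λ x → Edge G x (c j)) ci≡cj (pairwise i j i≢j)) edge-irrefl

  pairwise? : ∀ {w} (c : Fin w → V G) → Dec (Pairwise c)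
  pairwise? c = Fin.all? λ i → Fin.all? λ j → ¬? (i Fin.≟ j) →-dec (adj G (c i) (c j) Data.Bool.≟ true)

  hasClique? : ∀ w → Dec (HasClique G w)
  hasClique? w = map′
    (λ (N , pairwise) → finToFun N , pairwise⇒injective _ pairwise , pairwise)
    (λ (c , _ , pairwise) → funToFin c , λ i j i≢j →
       subst₂ (Edge G) (sym (Fin.finToFun-funToFin c i)) (sym (Fin.finToFun-funToFin c j)) (pairwise i j i≢j))
    (Fin.any? (pairwise? ∘ finToFun))

  cliqueNumber-exists : ∀ m → ¬ HasClique G (suc m) → ∃[ w ] w ≤ m × CliqueNumber G w
  cliqueNumber-exists m no-clique with hasClique? m
  ... | yes clique = m , ℕ.≤-refl , clique , no-clique
  cliqueNumber-exists zero no-clique | no no-clique₀ = contradiction ((λ ()) , (λ { {()} }) , (λ ())) no-clique₀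
  cliqueNumber-exists (suc m) no-clique | no no-clique′ =
    let w , w≤m , ω = cliqueNumber-exists m no-clique′ in w , ℕ.m≤n⇒m≤1+n w≤m , ω

  Colorable-mono : ∀ {k k′} → k ≤ k′ → Colorable G k → Colorable G k′
  Colorable-mono k≤k′ (c , proper) = (λ x → inject≤ (c x) k≤k′) , λ x y xy same →
    proper x y xy (Fin.inject≤-injective k≤k′ k≤k′ _ _ same)

chiBounded⇒colorable : ∀ {C} → ChiBounded C → ∀ m → ∃[ k ] ∀ G → C G → ¬ HasClique G (suc m) → Colorable G k
chiBounded⇒colorable (f , f-mono , bound) m = f m , λ G G∈C no-clique →
  let w , w≤m , ω = cliqueNumber-exists G m no-clique in Colorable-mono G (f-mono w≤m) (bound G G∈C w ω)

guarding-subclass : ∀ {A A′ : Class} → (∀ K → A K → A′ K) →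
  IntersectionwiseChiGuarding A′ → IntersectionwiseChiGuarding A
guarding-subclass A⊆A′ guarding B B-hereditary B-chiBounded =
  let f , f-mono , bound = guarding B B-hereditary B-chiBounded
  in f , f-mono , λ K (G , H , G∈A , H∈B , common) → bound K (G , H , A⊆A′ G G∈A , H∈B , common)

module Mirsky (H : Graph) (_≺_ : V H → V H → Set) (_≺?_ : ∀ x y → Dec (x ≺ y))
              (≺-trans : ∀ {x y z} → x ≺ y → y ≺ z → x ≺ z)
              (≺⇒edge : ∀ {x y} → x ≺ y → Edge H x y) (edge⇒≺ : ∀ {x y} → Edge H x y → x ≺ y ⊎ y ≺ x) where

  HeightAtMost : ℕ → V H → Set
  HeightAtMost zero x = ⊥
  HeightAtMost (suc d) x = ∀ y → y ≺ x → HeightAtMost d y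

  heightAtMost? : ∀ d x → Dec (HeightAtMost d x)
  heightAtMost? zero x = no id
  heightAtMost? (suc d) x = Fin.all? λ y → (y ≺? x) →-dec heightAtMost? d y

  chainBelow : ∀ d x → ¬ HeightAtMost (suc d) x →
    Σ (Fin (suc d) → V H) λ c → (∀ i → c i ≺ x) × Pairwise H c
  chainBelow d x too-high with Fin.¬∀⟶∃¬ _ _ (λ y → (y ≺? x) →-dec heightAtMost? d y) too-high
  ... | y , ¬below with y ≺? x | heightAtMost? d y
  ...   | no y⊀x | _ = contradiction (λ y≺x → contradiction y≺x y⊀x) ¬below
  ...   | yes _ | yes low = contradiction (λ _ → low) ¬below
  chainBelow zero x _ | y , _ | yes y≺x | no _ = (λ _ → y) , (λ _ → y≺x) , λ { 0F 0F 0≢0 → contradiction refl 0≢0 }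
  chainBelow (suc d) x _ | y , _ | yes y≺x | no high with chainBelow d y high
  ... | c , c≺y , pairwise = c′ , c′≺x , pairwise′
    where
    c′ : Fin (2 + d) → V H
    c′ 0F = y
    c′ (sucF i) = c i
    c′≺x : ∀ i → c′ i ≺ x
    c′≺x 0F = y≺x
    c′≺x (sucF i) = ≺-trans (c≺y i) y≺x
    pairwise′ : Pairwise H c′
    pairwise′ 0F 0F 0≢0 = contradiction refl 0≢0
    pairwise′ 0F (sucF j) _ = edge-sym H (≺⇒edge (c≺y j))
    pairwise′ (sucF i) 0F _ = ≺⇒edge (c≺y i)
    pairwise′ (sucF i) (sucF j) i≢j = pairwise i j (i≢j ∘ cong sucF)

  height : ∀ d x → HeightAtMost (suc d) x → ∃[ h ] h ≤ d × ¬ HeightAtMost h x × HeightAtMost (suc h) x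
  height zero x low = 0 , z≤n , id , low
  height (suc d) x low with heightAtMost? (suc d) x
  ... | no high = suc d , ℕ.≤-refl , high , low
  ... | yes lower = let h , h≤d , high , low′ = height d x lower in h , ℕ.m≤n⇒m≤1+n h≤d , high , low′

  colorable : ∀ w → ¬ HasClique H (suc w) → Colorable H (suc w)
  colorable w no-clique = colour , proper
    where
    bounded : ∀ x → HeightAtMost (suc w) x
    bounded x with heightAtMost? (suc w) x
    ... | yes low = low
    ... | no high = let c , _ , pairwise = chainBelow w x high
                    in contradiction (c , (λ {i} {j} → pairwise⇒injective H c pairwise {i} {j}) , pairwise) no-clique
    h : V H → ℕ
    h x = proj₁ (height w x (bounded x))
    colour : V H → Fin (suc w)
    colour x = Fin.fromℕ< (s≤s (proj₁ (proj₂ (height w x (bounded x)))))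
    same-height : ∀ {x y} → colour x ≡ colour y → h x ≡ h y
    same-height {x} {y} eq = trans (sym (Fin.toℕ-fromℕ< _)) (trans (cong toℕ eq) (Fin.toℕ-fromℕ< _))
    below⇒lower : ∀ {x y} → x ≺ y → h x ≢ h y
    below⇒lower {x} {y} x≺y hx≡hy =
      proj₁ (proj₂ (proj₂ (height w x (bounded x))))
        (subst (λ d → HeightAtMost d x) (sym hx≡hy) (proj₂ (proj₂ (proj₂ (height w y (bounded y)))) x x≺y))
    proper : ∀ x y → Edge H x y → colour x ≢ colour y
    proper x y xy same with edge⇒≺ xy
    ... | inj₁ x≺y = below⇒lower x≺y (same-height same)
    ... | inj₂ y≺x = below⇒lower y≺x (sym (same-height same))

-- (a , b) stands for the interval [a, b).
Precedes : ℕ × ℕ → ℕ × ℕ → Set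
Precedes (_ , b) (c , _) = b ≤ c

Disjoint : ℕ × ℕ → ℕ × ℕ → Set
Disjoint I J = Precedes I J ⊎ Precedes J I

disjoint? : ∀ I J → Dec (Disjoint I J)
disjoint? (_ , b) (c , d) = (b ℕ.≤? c) ⊎-dec (d ℕ.≤? _)

CoIntervalGraphs : Class
CoIntervalGraphs H = Σ (V H → ℕ × ℕ) λ I →
  (∀ x → proj₁ (I x) < proj₂ (I x)) × (∀ x y → adj H x y ≡ does (disjoint? (I x) (I y)))

coInterval-hereditary : Hereditary CoIntervalGraphs
coInterval-hereditary G H (f , _ , f-adj) (I , I-valid , I-adj) =
  I ∘ f , I-valid ∘ f , λ x y → trans (f-adj x y) (I-adj (f x) (f y))

coInterval-chiBounded : ChiBounded CoIntervalGraphs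
coInterval-chiBounded = suc , s≤s , λ H (I , I-valid , I-adj) w (_ , no-clique) →
  Mirsky.colorable H (λ x y → Precedes (I x) (I y)) (λ x y → proj₂ (I x) ℕ.≤? proj₁ (I y))
    (λ {x} {y} {z} x≺y y≺z → ℕ.≤-trans x≺y (ℕ.≤-trans (ℕ.<⇒≤ (I-valid y)) y≺z))
    (λ {x} {y} x≺y → trans (I-adj x y) (dec-true (disjoint? (I x) (I y)) (inj₁ x≺y)))
    (λ {x} {y} xy → does-true⇒ (disjoint? (I x) (I y)) (trans (sym (I-adj x y)) xy))
    w no-clique

-- Shift graphs

indicator : ∀ {P : Set} → Dec P → Fin 2
indicator (yes _) = 1F
indicator (no _) = 0F

indicator-sound : ∀ {P : Set} (P? : Dec P) → indicator P? ≡ 1F → P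
indicator-sound (yes p) _ = p

indicator-complete : ∀ {P : Set} (P? : Dec P) → P → indicator P? ≡ 1F
indicator-complete (yes _) _ = refl
indicator-complete (no ¬p) p = contradiction p ¬p

module ShiftGraph (G : Graph) where

  Forward : V G × V G → Set
  Forward (a , b) = toℕ a < toℕ b × Edge G a b

  forward? : ∀ e → Dec (Forward e)
  forward? (a , b) = (toℕ a ℕ.<? toℕ b) ×-dec (adj G a b Data.Bool.≟ true)

  pairs : List (V G × V G)
  pairs = cartesianProduct (allFin (n G)) (allFin (n G))

  edges : List (V G × V G)
  edges = filter forward? pairs

  m : ℕ
  m = length edges

  edge : Fin m → V G × V G
  edge = lookup edges

  tail head : Fin m → V G
  tail = proj₁ ∘ edge
  head = proj₂ ∘ edge

  edge-forward : ∀ x → Forward (edge x)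
  edge-forward x = All.lookup (All.all-filter forward? pairs) (∈.∈-lookup x)

  edge-injective : Injective _≡_ _≡_ edge
  edge-injective = Unique⇒lookup-injective
    (Unique.filter⁺ forward? {pairs} (Unique.cartesianProduct⁺ (Unique.allFin⁺ (n G)) (Unique.allFin⁺ (n G))))

  edge-surjective : ∀ a b → toℕ a < toℕ b → Edge G a b → ∃[ x ] edge x ≡ (a , b)
  edge-surjective a b a<b ab = Any.index ab∈ , sym (Any.lookup-index ab∈)
    where ab∈ = ∈.∈-filter⁺ forward? (∈.∈-cartesianProduct⁺ (∈.∈-allFin a) (∈.∈-allFin b)) (a<b , ab)

  SharesEnd : Fin m → Fin m → Set
  SharesEnd x y = x ≢ y × ShareEnd (edge x) (edge y)

  sharesEnd? : ∀ x y → Dec (SharesEnd x y)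
  sharesEnd? x y = ¬? (x Fin.≟ y) ×-dec
    (((tail x Fin.≟ tail y) ⊎-dec (tail x Fin.≟ head y)) ⊎-dec ((head x Fin.≟ tail y) ⊎-dec (head x Fin.≟ head y)))

  sharesEnd-sym : ∀ {x y} → SharesEnd x y → SharesEnd y x
  sharesEnd-sym (x≢y , share) = x≢y ∘ sym , swap-share share
    where
    swap-share : ∀ {e e′ : V G × V G} → ShareEnd e e′ → ShareEnd e′ e
    swap-share (inj₁ (inj₁ eq)) = inj₁ (inj₁ (sym eq))
    swap-share (inj₁ (inj₂ eq)) = inj₂ (inj₁ (sym eq))
    swap-share (inj₂ (inj₁ eq)) = inj₁ (inj₂ (sym eq))
    swap-share (inj₂ (inj₂ eq)) = inj₂ (inj₂ (sym eq))

  lineGraph : Graph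
  lineGraph = graphOf m SharesEnd sharesEnd? sharesEnd-sym (λ x≢x → proj₁ x≢x refl)

  lineGraph-isLineGraph : IsLineGraphOf lineGraph G
  lineGraph-isLineGraph = edge , edge-forward , edge-injective , edge-surjective ,
    λ x y x≢y → mk⇔ (proj₂ ∘ does-true⇒ (sharesEnd? x y)) (λ share → dec-true (sharesEnd? x y) (x≢y , share))

  interval : Fin m → ℕ × ℕ
  interval x = toℕ (tail x) , toℕ (head x)

  Separated : Fin m → Fin m → Set
  Separated x y = Disjoint (interval x) (interval y)

  separated-sym : ∀ {x y} → Separated x y → Separated y x
  separated-sym = Data.Sum.swap

  separated-irrefl : ∀ {x} → ¬ Separated x x
  separated-irrefl {x} (inj₁ head≤tail) = ℕ.<⇒≱ (proj₁ (edge-forward x)) head≤tail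
  separated-irrefl {x} (inj₂ head≤tail) = ℕ.<⇒≱ (proj₁ (edge-forward x)) head≤tail

  intervalGraph : Graph
  intervalGraph = graphOf m Separated (λ x y → disjoint? (interval x) (interval y)) separated-sym separated-irrefl

  shiftGraph : Graph
  shiftGraph = graphOf m (λ x y → SharesEnd x y × Separated x y) (λ x y → sharesEnd? x y ×-dec disjoint? (interval x) (interval y))
    (Data.Product.map sharesEnd-sym separated-sym) (separated-irrefl ∘ proj₂)

  -- The adjacency of a ×-dec decision is definitionally the ∧ of the two adjacencies.
  shiftGraph-intersection : ∀ {g} → GirthAtLeast g G → (LineGraphsOfGirth g ⊓ CoIntervalGraphs) shiftGraph
  shiftGraph-intersection girth = lineGraph , intervalGraph , (G , girth , lineGraph-isLineGraph) ,
    (interval , proj₁ ∘ edge-forward , λ x y → refl) , id , id , id , id , λ x y → refl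

  shift-edge : ∀ {x y} → Edge shiftGraph x y → SharesEnd x y × Separated x y
  shift-edge {x} {y} = does-true⇒ (sharesEnd? x y ×-dec disjoint? (interval x) (interval y))

  precedes⇒apart : ∀ {x y z} → Precedes (interval x) (interval y) → Precedes (interval y) (interval z) →
    ¬ ShareEnd (edge x) (edge z)
  precedes⇒apart {x} {y} {z} x≺y y≺z = λ
    { (inj₁ (inj₁ tx≡tz)) → ℕ.<-irrefl (cong toℕ tx≡tz) tail-x<tail-z
    ; (inj₁ (inj₂ tx≡hz)) → ℕ.<-irrefl (cong toℕ tx≡hz) (ℕ.<-trans tail-x<tail-z (proj₁ (edge-forward z)))
    ; (inj₂ (inj₁ hx≡tz)) → ℕ.<-irrefl (cong toℕ hx≡tz) head-x<tail-z
    ; (inj₂ (inj₂ hx≡hz)) → ℕ.<-irrefl (cong toℕ hx≡hz) (ℕ.<-trans head-x<tail-z (proj₁ (edge-forward z)))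
    }
    where
    head-x<tail-z : toℕ (head x) < toℕ (tail z)
    head-x<tail-z = ℕ.≤-<-trans x≺y (ℕ.<-≤-trans (proj₁ (edge-forward y)) y≺z)
    tail-x<tail-z : toℕ (tail x) < toℕ (tail z)
    tail-x<tail-z = ℕ.<-trans (proj₁ (edge-forward x)) head-x<tail-z

  shiftGraph-triangleFree : ¬ HasClique shiftGraph 3
  shiftGraph-triangleFree (c , _ , pairwise) = orient (separated 0F 1F λ ()) (separated 1F 2F λ ()) (separated 0F 2F λ ())
    where
    share : ∀ i j → i ≢ j → ShareEnd (edge (c i)) (edge (c j))
    share i j i≢j = proj₂ (proj₁ (shift-edge (pairwise i j i≢j)))
    separated : ∀ i j → i ≢ j → Separated (c i) (c j)
    separated i j i≢j = proj₂ (shift-edge (pairwise i j i≢j))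
    orient : Separated (c 0F) (c 1F) → Separated (c 1F) (c 2F) → Separated (c 0F) (c 2F) → ⊥
    orient (inj₁ 0≺1) (inj₁ 1≺2) _ = precedes⇒apart 0≺1 1≺2 (share 0F 2F λ ())
    orient (inj₂ 1≺0) (inj₂ 2≺1) _ = precedes⇒apart 2≺1 1≺0 (share 2F 0F λ ())
    orient (inj₁ _) (inj₂ 2≺1) (inj₁ 0≺2) = precedes⇒apart 0≺2 2≺1 (share 0F 1F λ ())
    orient (inj₁ 0≺1) (inj₂ _) (inj₂ 2≺0) = precedes⇒apart 2≺0 0≺1 (share 2F 1F λ ())
    orient (inj₂ 1≺0) (inj₁ _) (inj₁ 0≺2) = precedes⇒apart 1≺0 0≺2 (share 1F 2F λ ())
    orient (inj₂ _) (inj₁ 1≺2) (inj₂ 2≺0) = precedes⇒apart 1≺2 2≺0 (share 1F 0F λ ())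

  shiftGraph-colorable⇒colorable : ∀ {k} → Colorable shiftGraph k → Colorable G (2 ^ k)
  shiftGraph-colorable⇒colorable {k} (col , proper) = colour , colour-proper
    where
    leaves? : ∀ v γ → Dec (∃[ x ] tail x ≡ v × col x ≡ γ)
    leaves? v γ = Fin.any? λ x → (tail x Fin.≟ v) ×-dec (col x Fin.≟ γ)
    palette : V G → Fin k → Fin 2
    palette v γ = indicator (leaves? v γ)
    colour : V G → Fin (2 ^ k)
    colour v = funToFin (palette v)
    forward : ∀ a b → toℕ a < toℕ b → Edge G a b → colour a ≢ colour b
    forward a b a<b ab same with edge-surjective a b a<b ab
    ... | α , refl with indicator-sound (leaves? b (col α)) b-leaves
      where
      b-leaves : palette b (col α) ≡ 1F
      b-leaves = trans (sym (Fin.finToFun-funToFin (palette b) (col α)))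
                   (trans (cong (λ i → finToFun i (col α)) (sym same))
                     (trans (Fin.finToFun-funToFin (palette a) (col α))
                            (indicator-complete (leaves? a (col α)) (α , refl , refl))))
    ... | β , tail-β≡b , col≡ = proper α β α~β (sym col≡)
      where
      α~β : Edge shiftGraph α β
      α~β = dec-true (sharesEnd? α β ×-dec disjoint? (interval α) (interval β))
              (((λ { refl → ℕ.<-irrefl (cong toℕ tail-β≡b) a<b }) , inj₂ (inj₁ (sym tail-β≡b))) ,
               inj₁ (ℕ.≤-reflexive (cong toℕ (sym tail-β≡b))))
    colour-proper : ∀ x y → Edge G x y → colour x ≢ colour y
    colour-proper x y xy with ℕ.<-cmp (toℕ x) (toℕ y)
    ... | tri< x<y _ _ = forward x y x<y xy
    ... | tri> _ _ y<x = forward y x y<x (edge-sym G xy) ∘ sym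
    ... | tri≈ _ x≡y _ = contradiction (subst (Edge G x) (sym (Fin.toℕ-injective x≡y)) xy) (edge-irrefl G)

lineGraphsOfGirth-notGuarding : ∀ g → ¬ IntersectionwiseChiGuarding (LineGraphsOfGirth g)
lineGraphsOfGirth-notGuarding g guarding
  with chiBounded⇒colorable {LineGraphsOfGirth g ⊓ CoIntervalGraphs}
         (guarding CoIntervalGraphs coInterval-hereditary coInterval-chiBounded) 2
... | k , triangleFree⇒colorable with highGirth-notColorable g (2 ^ k) 2
... | H , notColorable , girth =
  toGraph-notColorable (NotColorable-pred {H = H} notColorable)
    (shiftGraph-colorable⇒colorable
      (triangleFree⇒colorable shiftGraph (shiftGraph-intersection {g} (toGraph-girth girth)) shiftGraph-triangleFree))
  where
  open TwoUniform H
  open ShiftGraph toGraph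

theorem4p3 : (∀ (g : ℕ) → 3 ≤ g → ¬ IntersectionwiseChiGuarding (LineGraphsOfGirth g))
    × ¬ IntersectionwiseChiGuarding LineGraphs
-- The construction works for every g.
theorem4p3 = (λ g _ → lineGraphsOfGirth-notGuarding g) ,
             lineGraphsOfGirth-notGuarding 3 ∘ guarding-subclass (λ K (G , _ , K≅L[G]) → G , K≅L[G])
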